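{- Let $(\mathbb{A},D)$ be an ultra-designated $\mathsf{Cobounded}$-algebra and $u,v\in\mathbf{V}^{(\mathbb{A})}$. Then $\llbracket u=v\rrbracket_{\mathrm{PA}}\in D$ if and only if the following hold: (a) for every $x\in\mathrm{dom}(u)$ with $u(x)\in D$ there is $y\in\mathrm{dom}(v)$ with $v(y)\in D$ and $\llbracket x=y\rrbracket_{\mathrm{PA}}\in D$, and for every $y\in\mathrm{dom}(v)$ with $v(y)\in D$ there is $x\in\mathrm{dom}(u)$ with $u(x)\in D$ and $\llbracket x=y\rrbracket_{\mathrm{PA}}\in D$; (b) for every $x\in\mathrm{dom}(u)$ with $u(x)=\mathbf{1}$ there is $y\in\mathrm{dom}(v)$ with $v(y)=\mathbf{1}$ and $\llbracket x=y\rrbracket_{\mathrm{PA}}\in D$, and for every $y\in\mathrm{dom}(v)$ with $v(y)=\mathbf{1}$ there is $x\in\mathrm{dom}(u)$ with $u(x)=\mathbf{1}$ and $\llbracket x=y\rrbracket_{\mathrm{PA}}\in D$.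
   Context: A designated set is a lattice filter $D$ with $\mathbf{1}\in D$, $\mathbf{0}\notin D$. A $\mathsf{Cobounded}$-algebra is $\langle\mathbf{A},\wedge,\vee,\Rightarrow,\mathbf{1},\mathbf{0}\rangle$ with complete distributive lattice reduct, such that $\bigvee_i a_i=\mathbf{1}$ implies some $a_j=\mathbf{1}$, $\bigwedge_i a_i=\mathbf{0}$ implies some $a_j=\mathbf{0}$, and $a\Rightarrow b=\mathbf{0}$ if $a\ne\mathbf{0},b=\mathbf{0}$, else $\mathbf{1}$. A designated $\mathsf{Cobounded}$-algebra $(\mathbb{A},D)$ adds ${}^*$: $a^*=\mathbf{0}$ if $a=\mathbf{1}$, $a^*=a$ if $a\in D\setminus\{\mathbf{1}\}$, $a^*=\mathbf{1}$ if $a\notin D$; ultra-designated if $D$ is an ultrafilter. $\mathbf{V}^{(\mathbb{A})}=\bigcup_\alpha\mathbf{V}^{(\mathbb{A})}_\alpha$, $\mathbf{V}^{(\mathbb{A})}_\alpha$ = functions with range in $\mathbf{A}$ and domain $\subseteq\mathbf{V}^{(\mathbb{A})}_\xi$ for some $\xi<\alpha$. Recursively: $\llbracket u\in v\rrbracket_{\mathrm{PA}}=\bigvee_{x\in\mathrm{dom}(v)}(v(x)\wedge\llbracket x=u\rrbracket_{\mathrm{PA}})$, $\llbracket u=v\rrbracket_{\mathrm{PA}}=\bigwedge_{x\in\mathrm{dom}(u)}((u(x)\Rightarrow\llbracket x\in v\rrbracket_{\mathrm{PA}})\wedge(\llbracket x\in v\rrbracket_{\mathrm{PA}}^*\Rightarrow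 u(x)^*))\wedge\bigwedge_{y\in\mathrm{dom}(v)}((v(y)\Rightarrow\llbracket y\in u\rrbracket_{\mathrm{PA}})\wedge(\llbracket y\in u\rrbracket_{\mathrm{PA}}^*\Rightarrow v(y)^*))$. -}

module Defs where

open import Level using (Level; suc)
open import Data.Product using (Σ; _×_)
open import Relation.Binary.PropositionalEquality using (_≡_; _≢_)
open import Relation.Nullary using (¬_)
open import Algebra.Lattice.Structures using (IsDistributiveLattice)

record CoboundedAlgebra (ℓ : Level) : Set (suc ℓ) where
  infixr 7 _∧_
  infixr 6 _∨_
  infixr 5 _⇒_
  field
    Carrier : Set ℓ
    _∧_ _∨_ _⇒_ : Carrier → Carrier → Carrier
    𝟏 𝟎 : Carrier
    ⋀ ⋁ : {I : Set ℓ} → (I → Carrier) → Carrier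
    isDistributiveLattice : IsDistributiveLattice _≡_ _∨_ _∧_

  _≤_ : Carrier → Carrier → Set ℓ
  a ≤ b = a ∧ b ≡ a

  field
    𝟎-least    : ∀ a → 𝟎 ≤ a
    𝟏-greatest : ∀ a → a ≤ 𝟏
    ⋁-upper    : ∀ {I : Set ℓ} (f : I → Carrier) (i : I) → f i ≤ ⋁ f
    ⋁-least    : ∀ {I : Set ℓ} (f : I → Carrier) (b : Carrier) → (∀ i → f i ≤ b) → ⋁ f ≤ b
    ⋀-lower    : ∀ {I : Set ℓ} (f : I → Carrier) (i : I) → ⋀ f ≤ f i
    ⋀-greatest : ∀ {I : Set ℓ} (f : I → Carrier) (b : Carrier) → (∀ i → b ≤ f i) → b ≤ ⋀ f
    ⋁-𝟏 : ∀ {I : Set ℓ} (f : I → Carrier) → ⋁ f ≡ 𝟏 → Σ I (λ j → f j ≡ 𝟏)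
    ⋀-𝟎 : ∀ {I : Set ℓ} (f : I → Carrier) → ⋀ f ≡ 𝟎 → Σ I (λ j → f j ≡ 𝟎)
    ⇒-𝟎 : ∀ a b → a ≢ 𝟎 → b ≡ 𝟎 → (a ⇒ b) ≡ 𝟎
    ⇒-𝟏 : ∀ a b → ¬ (a ≢ 𝟎 × b ≡ 𝟎) → (a ⇒ b) ≡ 𝟏

module _ {ℓ : Level} (𝔸 : CoboundedAlgebra ℓ) where
  open CoboundedAlgebra 𝔸

  record IsFilter (F : Carrier → Set ℓ) : Set ℓ where
    field
      nonempty : Σ Carrier F
      up-closed : ∀ a b → a ≤ b → F a → F b
      ∧-closed  : ∀ a b → F a → F b → F (a ∧ b)

  record IsDesignatedSet (D : Carrier → Set ℓ) : Set ℓ where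
    field
      isFilter : IsFilter D
      𝟏∈D : D 𝟏
      𝟎∉D : ¬ D 𝟎

  record IsUltraDesignatedSet (D : Carrier → Set ℓ) : Set (suc ℓ) where
    field
      isDesignatedSet : IsDesignatedSet D
      maximal : ∀ (F : Carrier → Set ℓ) → IsFilter F → ¬ F 𝟎 →
                (∀ a → D a → F a) → ∀ a → F a → D a

  record IsStar (D : Carrier → Set ℓ) (_* : Carrier → Carrier) : Set ℓ where
    field
      star-𝟏   : ∀ a → a ≡ 𝟏 → (a *) ≡ 𝟎
      star-D   : ∀ a → D a → a ≢ 𝟏 → (a *) ≡ a
      star-notD : ∀ a → ¬ D a → (a *) ≡ 𝟏

  -- names: V^(A) as well-founded trees; a name u is a family of names
  -- (its domain, indexed by dom u) together with the values u(x).
  data V : Set (suc ℓ) where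
    mk : (I : Set ℓ) → (I → V) → (I → Carrier) → V

  dom : V → Set ℓ
  dom (mk I _ _) = I

  elt : (u : V) → dom u → V
  elt (mk _ e _) = e

  val : (u : V) → dom u → Carrier
  val (mk _ _ f) = f

  module PA (_* : Carrier → Carrier) where
    mutual
      ⟦_∈_⟧ : V → V → Carrier
      ⟦ u ∈ mk J e f ⟧ = ⋁ (λ (j : J) → f j ∧ ⟦ e j ≡ u ⟧)

      ⟦_≡_⟧ : V → V → Carrier
      ⟦ mk I a g ≡ mk J b h ⟧ =
        ⋀ (λ (i : I) → (g i ⇒ ⟦ a i ∈ mk J b h ⟧) ∧ ((⟦ a i ∈ mk J b h ⟧ *) ⇒ (g i *)))
        ∧ ⋀ (λ (j : J) → (h j ⇒ ⟦ b j ∈ mk I a g ⟧) ∧ ((⟦ b j ∈ mk I a g ⟧ *) ⇒ (h j *)))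

{-# OPTIONS --safe #-}

-- Since 𝟎 is meet-irreducible, the nonzero elements form a proper filter, so
-- the ultrafilter D consists exactly of the nonzero elements; with excluded
-- middle it is then prime for arbitrary joins, and 𝟏 is join-irreducible by
-- coboundedness. Every value of ⇒ lies in {𝟎, 𝟏}, hence so does every ⟦s = t⟧.
-- Since a* ∈ D iff a ≠ 𝟏, the conjunct (a ⇒ b) ∧ (b* ⇒ a*) of ⟦u = v⟧ lies in D
-- iff (a ∈ D → b ∈ D) and (a = 𝟏 → b = 𝟏). Taking a = u(x), b = ⟦x ∈ v⟧ and
-- unfolding ⟦x ∈ v⟧ as a join gives conditions (a) and (b).

module Submission where

open import Defs
open import Level using (Level; Lift; lift)
open import Data.Bool using (Bool; true; false)
open import Data.Product using (Σ; _×_; _,_; proj₁; proj₂; map₂)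
open import Data.Product.Function.NonDependent.Propositional using (_×-⇔_)
open import Data.Sum using (_⊎_; inj₁; inj₂; [_,_])
open import Function using (_∘_)
open import Function.Bundles using (_⇔_; mk⇔; Equivalence)
open import Function.Properties.Equivalence using () renaming (trans to ⇔-trans)
open import Relation.Binary.PropositionalEquality
  using (_≡_; _≢_; refl; sym; trans; cong; subst; module ≡-Reasoning)
open import Relation.Nullary using (¬_; yes; no)
open import Axiom.ExcludedMiddle using (ExcludedMiddle)
open import Axiom.DoubleNegationElimination using (DoubleNegationElimination; em⇒dne)
open import Algebra.Lattice.Bundles using (DistributiveLattice)
import Algebra.Lattice.Properties.Lattice as LatticeProperties

open Equivalence using (to; from)

module CoboundedAlgebraProperties {ℓ : Level} (𝔸 : CoboundedAlgebra ℓ) where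

  open CoboundedAlgebra 𝔸

  distributiveLattice : DistributiveLattice ℓ ℓ
  distributiveLattice = record
    { Carrier = Carrier ; _≈_ = _≡_ ; _∨_ = _∨_ ; _∧_ = _∧_
    ; isDistributiveLattice = isDistributiveLattice }

  open DistributiveLattice distributiveLattice using (∧-comm; ∧-assoc; lattice)
  open LatticeProperties lattice using (∧-idem)

  ∧-zeroʳ : ∀ a → a ∧ 𝟎 ≡ 𝟎
  ∧-zeroʳ a = trans (∧-comm a 𝟎) (𝟎-least a)

  ∧-identityˡ : ∀ a → 𝟏 ∧ a ≡ a
  ∧-identityˡ a = trans (∧-comm 𝟏 a) (𝟏-greatest a)

  x∧y≤x : ∀ a b → (a ∧ b) ≤ a
  x∧y≤x a b = begin
    (a ∧ b) ∧ a  ≡⟨ ∧-comm (a ∧ b) a ⟩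
    a ∧ (a ∧ b)  ≡⟨ sym (∧-assoc a a b) ⟩
    (a ∧ a) ∧ b  ≡⟨ cong (_∧ b) (∧-idem a) ⟩
    a ∧ b        ∎
    where open ≡-Reasoning

  x∧y≤y : ∀ a b → (a ∧ b) ≤ b
  x∧y≤y a b = trans (∧-assoc a b b) (cong (a ∧_) (∧-idem b))

  ≤𝟎⇒≡𝟎 : ∀ {a} → a ≤ 𝟎 → a ≡ 𝟎
  ≤𝟎⇒≡𝟎 {a} a≤𝟎 = trans (sym a≤𝟎) (∧-zeroʳ a)

  𝟏≤⇒≡𝟏 : ∀ {a} → 𝟏 ≤ a → a ≡ 𝟏
  𝟏≤⇒≡𝟏 {a} 𝟏≤a = trans (sym (∧-identityˡ a)) 𝟏≤a

  ∧-≡𝟏 : ∀ {a b} → a ∧ b ≡ 𝟏 ⇔ (a ≡ 𝟏 × b ≡ 𝟏)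
  ∧-≡𝟏 {a} {b} = mk⇔
    (λ a∧b≡𝟏 → 𝟏≤⇒≡𝟏 (subst (_≤ a) a∧b≡𝟏 (x∧y≤x a b))
             , 𝟏≤⇒≡𝟏 (subst (_≤ b) a∧b≡𝟏 (x∧y≤y a b)))
    (λ { (refl , refl) → 𝟏-greatest 𝟏 })

  ⋀-𝟏 : ∀ {I : Set ℓ} {f : I → Carrier} → (∀ i → f i ≡ 𝟏) → ⋀ f ≡ 𝟏
  ⋀-𝟏 {f = f} f≡𝟏 = 𝟏≤⇒≡𝟏 (⋀-greatest f 𝟏 λ i → trans (∧-identityˡ (f i)) (f≡𝟏 i))

  ⋁-≡𝟏 : ∀ {I : Set ℓ} {f : I → Carrier} → ⋁ f ≡ 𝟏 ⇔ Σ I (λ i → f i ≡ 𝟏)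
  ⋁-≡𝟏 {f = f} = mk⇔ (⋁-𝟏 f)
    (λ (i , fi≡𝟏) → 𝟏≤⇒≡𝟏 (subst (_≤ ⋁ f) fi≡𝟏 (⋁-upper f i)))

  ∧-≡𝟎 : ∀ {a b} → a ∧ b ≡ 𝟎 → a ≡ 𝟎 ⊎ b ≡ 𝟎
  ∧-≡𝟎 {a} {b} a∧b≡𝟎 with ⋀-𝟎 pair ⋀pair≡𝟎
    where
    pair : Lift ℓ Bool → Carrier
    pair (lift true)  = a
    pair (lift false) = b

    ⋀pair≡𝟎 : ⋀ pair ≡ 𝟎
    ⋀pair≡𝟎 = ≤𝟎⇒≡𝟎 (begin
      ⋀ pair ∧ 𝟎        ≡⟨ cong (⋀ pair ∧_) (sym a∧b≡𝟎) ⟩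
      ⋀ pair ∧ (a ∧ b)  ≡⟨ sym (∧-assoc (⋀ pair) a b) ⟩
      (⋀ pair ∧ a) ∧ b  ≡⟨ cong (_∧ b) (⋀-lower pair (lift true)) ⟩
      ⋀ pair ∧ b        ≡⟨ ⋀-lower pair (lift false) ⟩
      ⋀ pair            ∎)
      where open ≡-Reasoning
  ... | lift true  , a≡𝟎 = inj₁ a≡𝟎
  ... | lift false , b≡𝟎 = inj₂ b≡𝟎

  ≢𝟎-isFilter : 𝟏 ≢ 𝟎 → IsFilter 𝔸 (_≢ 𝟎)
  ≢𝟎-isFilter 𝟏≢𝟎 = record
    { nonempty  = 𝟏 , 𝟏≢𝟎
    ; up-closed = λ a b a≤b a≢𝟎 b≡𝟎 →
        a≢𝟎 (trans (sym a≤b) (trans (cong (a ∧_) b≡𝟎) (∧-zeroʳ a)))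
    ; ∧-closed  = λ a b a≢𝟎 b≢𝟎 → [ a≢𝟎 , b≢𝟎 ] ∘ ∧-≡𝟎
    }

  ⟦≡⟧-sym : (_* : Carrier → Carrier) → ∀ s t → PA.⟦_≡_⟧ 𝔸 _* s t ≡ PA.⟦_≡_⟧ 𝔸 _* t s
  ⟦≡⟧-sym _* (mk _ _ _) (mk _ _ _) = ∧-comm _ _

module UltraDesignated {ℓ : Level} (em : ExcludedMiddle ℓ) (𝔸 : CoboundedAlgebra ℓ)
    (D : CoboundedAlgebra.Carrier 𝔸 → Set ℓ) (U : IsUltraDesignatedSet 𝔸 D) where

  open CoboundedAlgebra 𝔸
  open CoboundedAlgebraProperties 𝔸
  open IsUltraDesignatedSet U
  open IsDesignatedSet isDesignatedSet
  open IsFilter isFilter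

  dne : DoubleNegationElimination ℓ
  dne = em⇒dne em

  𝟏≢𝟎 : 𝟏 ≢ 𝟎
  𝟏≢𝟎 𝟏≡𝟎 = 𝟎∉D (subst D 𝟏≡𝟎 𝟏∈D)

  D⇒≢𝟎 : ∀ {a} → D a → a ≢ 𝟎
  D⇒≢𝟎 Da refl = 𝟎∉D Da

  ≢𝟎⇒D : ∀ {a} → a ≢ 𝟎 → D a
  ≢𝟎⇒D {a} = maximal (_≢ 𝟎) (≢𝟎-isFilter 𝟏≢𝟎) (λ 𝟎≢𝟎 → 𝟎≢𝟎 refl) (λ _ → D⇒≢𝟎) a

  ¬D⇒≡𝟎 : ∀ {a} → ¬ D a → a ≡ 𝟎
  ¬D⇒≡𝟎 ¬Da = dne (¬Da ∘ ≢𝟎⇒D)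

  D-∧ : ∀ {a b} → D (a ∧ b) ⇔ (D a × D b)
  D-∧ {a} {b} = mk⇔
    (λ Da∧b → up-closed _ _ (x∧y≤x a b) Da∧b , up-closed _ _ (x∧y≤y a b) Da∧b)
    (λ (Da , Db) → ∧-closed a b Da Db)

  D-⋀ : ∀ {I : Set ℓ} {f : I → Carrier} → D (⋀ f) ⇔ (∀ i → D (f i))
  D-⋀ {f = f} = mk⇔
    (λ D⋀f i → up-closed _ _ (⋀-lower f i) D⋀f)
    (λ Df → ≢𝟎⇒D λ ⋀f≡𝟎 → let (j , fj≡𝟎) = ⋀-𝟎 f ⋀f≡𝟎 in D⇒≢𝟎 (Df j) fj≡𝟎)

  D-⋁ : ∀ {I : Set ℓ} {f : I → Carrier} → D (⋁ f) ⇔ Σ I (D ∘ f)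
  D-⋁ {I} {f} = mk⇔
    (λ D⋁f → dne λ ¬∃ → D⇒≢𝟎 D⋁f (≤𝟎⇒≡𝟎 (⋁-least f 𝟎 (f≤𝟎 ¬∃))))
    (λ (i , Dfi) → up-closed _ _ (⋁-upper f i) Dfi)
    where
    f≤𝟎 : ¬ Σ I (D ∘ f) → ∀ i → f i ≤ 𝟎
    f≤𝟎 ¬∃ i = trans (∧-zeroʳ (f i)) (sym (¬D⇒≡𝟎 (¬∃ ∘ (i ,_))))

  D-⇒ : ∀ {a b} → D (a ⇒ b) ⇔ (D a → D b)
  D-⇒ {a} {b} = mk⇔
    (λ Da⇒b Da → ≢𝟎⇒D λ b≡𝟎 → D⇒≢𝟎 Da⇒b (⇒-𝟎 a b (D⇒≢𝟎 Da) b≡𝟎))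
    (λ Da→Db → subst D (sym (⇒-𝟏 a b λ (a≢𝟎 , b≡𝟎) → D⇒≢𝟎 (Da→Db (≢𝟎⇒D a≢𝟎)) b≡𝟎)) 𝟏∈D)

  -- Since D is ultra, Crisp a says that a is 𝟎 or 𝟏.
  Crisp : Carrier → Set ℓ
  Crisp a = D a → a ≡ 𝟏

  ⇒-crisp : ∀ a b → Crisp (a ⇒ b)
  ⇒-crisp a b Da⇒b = ⇒-𝟏 a b λ (a≢𝟎 , b≡𝟎) → D⇒≢𝟎 Da⇒b (⇒-𝟎 a b a≢𝟎 b≡𝟎)

  ∧-crisp : ∀ {a b} → Crisp a → Crisp b → Crisp (a ∧ b)
  ∧-crisp crisp-a crisp-b Da∧b =
    let (Da , Db) = to D-∧ Da∧b in from ∧-≡𝟏 (crisp-a Da , crisp-b Db)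

  ⋀-crisp : ∀ {I : Set ℓ} {f : I → Carrier} → (∀ i → Crisp (f i)) → Crisp (⋀ f)
  ⋀-crisp crisp-f D⋀f = ⋀-𝟏 λ i → crisp-f i (to D-⋀ D⋀f i)

  module Star (_* : Carrier → Carrier) (S : IsStar 𝔸 D _*) where

    open IsStar S
    open PA 𝔸 _*

    D-* : ∀ {a} → D (a *) ⇔ (a ≢ 𝟏)
    D-* {a} = mk⇔ (λ Da* a≡𝟏 → 𝟎∉D (subst D (star-𝟏 a a≡𝟏) Da*)) D*
      where
      D* : a ≢ 𝟏 → D (a *)
      D* a≢𝟏 with em {D a}
      ... | yes Da = subst D (sym (star-D a Da a≢𝟏)) Da
      ... | no ¬Da = subst D (sym (star-notD a ¬Da)) 𝟏∈D

    D-*⇒* : ∀ {a b} → D ((a *) ⇒ (b *)) ⇔ (b ≡ 𝟏 → a ≡ 𝟏)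
    D-*⇒* = mk⇔
      (λ Da*⇒b* b≡𝟏 → dne λ a≢𝟏 → to D-* (to D-⇒ Da*⇒b* (from D-* a≢𝟏)) b≡𝟏)
      (λ b≡𝟏→a≡𝟏 → from D-⇒ λ Da* → from D-* λ b≡𝟏 → to D-* Da* (b≡𝟏→a≡𝟏 b≡𝟏))

    D-⇒∧*⇒* : ∀ {a b} → D ((a ⇒ b) ∧ ((b *) ⇒ (a *))) ⇔ ((D a → D b) × (a ≡ 𝟏 → b ≡ 𝟏))
    D-⇒∧*⇒* = ⇔-trans D-∧ (D-⇒ ×-⇔ D-*⇒*)

    D-⋀⇒∧*⇒* : ∀ {I : Set ℓ} {f g : I → Carrier} →
      D (⋀ λ i → (f i ⇒ g i) ∧ ((g i *) ⇒ (f i *))) ⇔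
        ((∀ i → D (f i) → D (g i)) × (∀ i → f i ≡ 𝟏 → g i ≡ 𝟏))
    D-⋀⇒∧*⇒* = mk⇔
      (λ D⋀ → (λ i → proj₁ (to D-⇒∧*⇒* (to D-⋀ D⋀ i)))
            , (λ i → proj₂ (to D-⇒∧*⇒* (to D-⋀ D⋀ i))))
      (λ (D→D , 𝟏→𝟏) → from D-⋀ λ i → from D-⇒∧*⇒* (D→D i , 𝟏→𝟏 i))

    ⟦≡⟧-crisp : ∀ s t → Crisp ⟦ s ≡ t ⟧
    ⟦≡⟧-crisp (mk _ _ _) (mk _ _ _) =
      ∧-crisp (⋀-crisp λ _ → ∧-crisp (⇒-crisp _ _) (⇒-crisp _ _))
              (⋀-crisp λ _ → ∧-crisp (⇒-crisp _ _) (⇒-crisp _ _))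

    ⟦≡⟧-≡𝟏 : ∀ s t → ⟦ s ≡ t ⟧ ≡ 𝟏 ⇔ D ⟦ s ≡ t ⟧
    ⟦≡⟧-≡𝟏 s t = mk⇔ (λ ⟦s≡t⟧≡𝟏 → subst D (sym ⟦s≡t⟧≡𝟏) 𝟏∈D) (⟦≡⟧-crisp s t)

    D-⟦∈⟧ : ∀ x v → D ⟦ x ∈ v ⟧ ⇔ Σ (dom 𝔸 v) λ y → D (val 𝔸 v y) × D ⟦ elt 𝔸 v y ≡ x ⟧
    D-⟦∈⟧ x (mk _ _ _) = mk⇔ (map₂ (to D-∧) ∘ to D-⋁) (from D-⋁ ∘ map₂ (from D-∧))

    ⟦∈⟧-≡𝟏 : ∀ x v → ⟦ x ∈ v ⟧ ≡ 𝟏 ⇔ Σ (dom 𝔸 v) λ y → val 𝔸 v y ≡ 𝟏 × D ⟦ elt 𝔸 v y ≡ x ⟧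
    ⟦∈⟧-≡𝟏 x (mk _ b _) = mk⇔
      (λ ⟦x∈v⟧≡𝟏 → let (y , vy∧⟦≡⟧≡𝟏) = to ⋁-≡𝟏 ⟦x∈v⟧≡𝟏
                       (vy≡𝟏 , ⟦≡⟧≡𝟏) = to ∧-≡𝟏 vy∧⟦≡⟧≡𝟏
                   in y , vy≡𝟏 , to (⟦≡⟧-≡𝟏 (b y) x) ⟦≡⟧≡𝟏)
      (λ (y , vy≡𝟏 , D⟦≡⟧) → from ⋁-≡𝟏 (y , from ∧-≡𝟏 (vy≡𝟏 , from (⟦≡⟧-≡𝟏 (b y) x) D⟦≡⟧)))

    D-⟦≡⟧-comm : ∀ s t → D ⟦ s ≡ t ⟧ → D ⟦ t ≡ s ⟧
    D-⟦≡⟧-comm s t = subst D (⟦≡⟧-sym _* s t)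

    Included : (Carrier → Set ℓ) → V 𝔸 → V 𝔸 → Set ℓ
    Included P u v = (x : dom 𝔸 u) → P (val 𝔸 u x) → P ⟦ elt 𝔸 u x ∈ v ⟧

    D-⟦≡⟧ : ∀ u v → D ⟦ u ≡ v ⟧ ⇔
      ((Included D u v × Included D v u) × (Included (_≡ 𝟏) u v × Included (_≡ 𝟏) v u))
    D-⟦≡⟧ (mk _ _ _) (mk _ _ _) = mk⇔
      (λ D⟦u≡v⟧ → let (D⊆ , D⊇) = to D-∧ D⟦u≡v⟧
                      (Du⊆v , 𝟏u⊆v) = to D-⋀⇒∧*⇒* D⊆
                      (Dv⊆u , 𝟏v⊆u) = to D-⋀⇒∧*⇒* D⊇
                  in (Du⊆v , Dv⊆u) , (𝟏u⊆v , 𝟏v⊆u))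
      (λ ((Du⊆v , Dv⊆u) , (𝟏u⊆v , 𝟏v⊆u)) →
         from D-∧ (from D-⋀⇒∧*⇒* (Du⊆v , 𝟏u⊆v) , from D-⋀⇒∧*⇒* (Dv⊆u , 𝟏v⊆u)))

    Forth Back : (Carrier → Set ℓ) → V 𝔸 → V 𝔸 → Set ℓ
    Forth P u v = (x : dom 𝔸 u) → P (val 𝔸 u x) →
      Σ (dom 𝔸 v) λ y → P (val 𝔸 v y) × D ⟦ elt 𝔸 u x ≡ elt 𝔸 v y ⟧
    Back P u v = (y : dom 𝔸 v) → P (val 𝔸 v y) →
      Σ (dom 𝔸 u) λ x → P (val 𝔸 u x) × D ⟦ elt 𝔸 u x ≡ elt 𝔸 v y ⟧

    module _ (P : Carrier → Set ℓ)
        (P-⟦∈⟧ : ∀ x v → P ⟦ x ∈ v ⟧ ⇔ Σ (dom 𝔸 v) λ y → P (val 𝔸 v y) × D ⟦ elt 𝔸 v y ≡ x ⟧)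
        where

      Included⇔Forth : ∀ u v → Included P u v ⇔ Forth P u v
      Included⇔Forth u v = mk⇔
        (λ u⊆v x Px → let (y , Pvy , D⟦≡⟧) = to (P-⟦∈⟧ (elt 𝔸 u x) v) (u⊆v x Px)
                       in y , Pvy , D-⟦≡⟧-comm (elt 𝔸 v y) (elt 𝔸 u x) D⟦≡⟧)
        (λ forth x Px → let (y , Pvy , D⟦≡⟧) = forth x Px
                         in from (P-⟦∈⟧ (elt 𝔸 u x) v)
                              (y , Pvy , D-⟦≡⟧-comm (elt 𝔸 u x) (elt 𝔸 v y) D⟦≡⟧))

      Included⇔Back : ∀ u v → Included P v u ⇔ Back P u v
      Included⇔Back u v = mk⇔
        (λ v⊆u y Py → to (P-⟦∈⟧ (elt 𝔸 v y) u) (v⊆u y Py))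
        (λ back y Py → from (P-⟦∈⟧ (elt 𝔸 v y) u) (back y Py))

      Included⇔ForthBack : ∀ u v → (Included P u v × Included P v u) ⇔ (Forth P u v × Back P u v)
      Included⇔ForthBack u v = Included⇔Forth u v ×-⇔ Included⇔Back u v

mainTheorem8 : ∀ {ℓ : Level} → ExcludedMiddle ℓ →
    (𝔸 : CoboundedAlgebra ℓ) (D : CoboundedAlgebra.Carrier 𝔸 → Set ℓ) →
    IsUltraDesignatedSet 𝔸 D →
    (_* : CoboundedAlgebra.Carrier 𝔸 → CoboundedAlgebra.Carrier 𝔸) → IsStar 𝔸 D _* →
    (u v : V 𝔸) →
    D (PA.⟦_≡_⟧ 𝔸 _* u v) ⇔
      ((((x : dom 𝔸 u) → D (val 𝔸 u x) →
            Σ (dom 𝔸 v) (λ y → D (val 𝔸 v y) × D (PA.⟦_≡_⟧ 𝔸 _* (elt 𝔸 u x) (elt 𝔸 v y))))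
        × ((y : dom 𝔸 v) → D (val 𝔸 v y) →
            Σ (dom 𝔸 u) (λ x → D (val 𝔸 u x) × D (PA.⟦_≡_⟧ 𝔸 _* (elt 𝔸 u x) (elt 𝔸 v y)))))
      × (((x : dom 𝔸 u) → val 𝔸 u x ≡ CoboundedAlgebra.𝟏 𝔸 →
            Σ (dom 𝔸 v) (λ y → val 𝔸 v y ≡ CoboundedAlgebra.𝟏 𝔸 × D (PA.⟦_≡_⟧ 𝔸 _* (elt 𝔸 u x) (elt 𝔸 v y))))
        × ((y : dom 𝔸 v) → val 𝔸 v y ≡ CoboundedAlgebra.𝟏 𝔸 →
            Σ (dom 𝔸 u) (λ x → val 𝔸 u x ≡ CoboundedAlgebra.𝟏 𝔸 × D (PA.⟦_≡_⟧ 𝔸 _* (elt 𝔸 u x) (elt 𝔸 v y))))))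
mainTheorem8 em 𝔸 D U _* S u v =
  ⇔-trans (D-⟦≡⟧ u v)
    (Included⇔ForthBack D D-⟦∈⟧ u v ×-⇔ Included⇔ForthBack (_≡ 𝟏) ⟦∈⟧-≡𝟏 u v)
  where
  open CoboundedAlgebra 𝔸 using (𝟏)
  open UltraDesignated.Star em 𝔸 D U _* S
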